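{- Let $G$ be a finite unweighted undirected graph with $n$ vertices and $m$ edges, and let $\Gamma_{\text{ec}}$ be its family of edge covers. Then $\mathrm{Mod}_2(\Gamma_{\text{ec}})\le m\lceil n/2\rceil^{ -2}$.
   Context: An edge cover is a set $C$ of edges such that every vertex is incident to at least one edge of $C$; it is identified with its indicator vector in $\mathbb{R}^E$. For a density $\rho\in\mathbb{R}^E_{\ge0}$, $\rho$ is admissible for $\Gamma_{\text{ec}}$ if $\sum_{e\in C}\rho(e)\ge1$ for every edge cover $C$; $\mathrm{Mod}_2(\Gamma_{\text{ec}})=\inf\{\sum_{e\in E}\rho(e)^2:\rho\text{ admissible}\}$. -}

module Defs where

open import Data.Nat using (ℕ; zero; suc)
open import Data.Fin using (Fin; zero; suc)
open import Data.Bool using (Bool; true; false; if_then_else_)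
open import Data.Product using (_×_; _,_; proj₁; proj₂; ∃-syntax)
open import Data.Sum using (_⊎_)
open import Relation.Binary.PropositionalEquality using (_≡_; _≢_)
open import Data.Rational using (ℚ; 0ℚ; 1ℚ; _+_; _*_; _≤_; _<_; Positive)

SameEdge : ∀ {n} → Fin n × Fin n → Fin n × Fin n → Set
SameEdge (a , b) (c , d) = (a ≡ c × b ≡ d) ⊎ (a ≡ d × b ≡ c)

record SimpleGraph (n m : ℕ) : Set where
  field
    ends     : Fin m → Fin n × Fin n
    loopless : ∀ e → proj₁ (ends e) ≢ proj₂ (ends e)
    simple   : ∀ e f → SameEdge (ends e) (ends f) → e ≡ f

open SimpleGraph public

Incident : ∀ {n m} → SimpleGraph n m → Fin n → Fin m → Set
Incident G v e = (v ≡ proj₁ (ends G e)) ⊎ (v ≡ proj₂ (ends G e))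

EdgeSet : ℕ → Set
EdgeSet m = Fin m → Bool

IsEdgeCover : ∀ {n m} → SimpleGraph n m → EdgeSet m → Set
IsEdgeCover G C = ∀ v → ∃[ e ] (C e ≡ true × Incident G v e)

sumℚ : ∀ {m} → (Fin m → ℚ) → ℚ
sumℚ {zero}  f = 0ℚ
sumℚ {suc m} f = f zero + sumℚ (λ i → f (suc i))

Density : ℕ → Set
Density m = Fin m → ℚ

lengthOf : ∀ {m} → Density m → EdgeSet m → ℚ
lengthOf ρ C = sumℚ (λ e → if C e then ρ e else 0ℚ)

Admissible : ∀ {n m} → SimpleGraph n m → Density m → Set
Admissible G ρ = (∀ e → 0ℚ ≤ ρ e) × (∀ C → IsEdgeCover G C → 1ℚ ≤ lengthOf ρ C)

energy : ∀ {m} → Density m → ℚ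
energy ρ = sumℚ (λ e → ρ e * ρ e)

-- Mod₂(Γ_ec(G)) ≤ c, i.e. inf{energy ρ : ρ admissible} ≤ c, unfolded as:
-- for every ε > 0 there is an admissible ρ with energy ρ < c + ε.
Mod2-ec≤ : ∀ {n m} → SimpleGraph n m → ℚ → Set
Mod2-ec≤ G c = ∀ (ε : ℚ) → Positive ε → ∃[ ρ ] (Admissible G ρ × energy ρ < c + ε)

-- Put the constant density 1/k on every edge, where k = ⌈n/2⌉. The endpoints of an edge
-- cover C, 2|C| of them counted with multiplicity, include every vertex, so |C| ≥ ⌈n/2⌉ and
-- the density is admissible; its energy is m/k² exactly.

module Submission where

open import Defs
open import Data.Nat using (ℕ; suc; ⌈_/2⌉) renaming (_*_ to _*ℕ_)
open import Data.Integer using (+_)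
open import Data.Rational using (_/_)

open import Data.Nat as ℕ using (zero; NonZero)
import Data.Nat.Properties as ℕ
import Data.Integer as ℤ
import Data.Integer.Properties as ℤ
open import Data.Integer.Solver using (module +-*-Solver)
import Data.Rational.Unnormalised as ℚᵘ
open import Data.Rational.Unnormalised using (mkℚᵘ; *≡*; *≤*)
import Data.Rational.Unnormalised.Properties as ℚᵘ
open import Data.Rational as ℚ using (0ℚ; 1ℚ; toℚᵘ; fromℚᵘ; Positive)
open import Data.Rational.Properties as ℚ
  using (toℚᵘ-injective; toℚᵘ-fromℚᵘ; fromℚᵘ-cong; toℚᵘ-homo-+; toℚᵘ-homo-*)
open import Data.Fin using (Fin; zero; suc)
open import Data.Fin.Properties using (injective⇒≤)
open import Data.List using (List; length; map; _++_; tabulate; allFin; filterᵇ)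
open import Data.List.Properties using (length-++; length-map)
open import Data.List.Membership.Propositional using (_∈_)
open import Data.List.Membership.Propositional.Properties
  using (∈-allFin; ∈-filter⁺; ∈-map⁺; ∈-++⁺ˡ; ∈-++⁺ʳ)
open import Data.List.Membership.Setoid.Properties using (index-injective)
open import Data.Bool using (Bool; true; false; if_then_else_; T)
open import Relation.Nullary using (T?)
open import Data.Product using (_,_; proj₁; proj₂)
open import Data.Sum using (inj₁; inj₂)
open import Function using (_∘_)
open import Relation.Binary.PropositionalEquality

fromℚᵘ-homo-+ : ∀ p q → fromℚᵘ (p ℚᵘ.+ q) ≡ fromℚᵘ p ℚ.+ fromℚᵘ q
fromℚᵘ-homo-+ p q = toℚᵘ-injective (begin
  toℚᵘ (fromℚᵘ (p ℚᵘ.+ q))                  ≈⟨ toℚᵘ-fromℚᵘ (p ℚᵘ.+ q) ⟩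
  p ℚᵘ.+ q                                   ≈⟨ ℚᵘ.+-cong (toℚᵘ-fromℚᵘ p) (toℚᵘ-fromℚᵘ q) ⟨
  toℚᵘ (fromℚᵘ p) ℚᵘ.+ toℚᵘ (fromℚᵘ q)       ≈⟨ toℚᵘ-homo-+ (fromℚᵘ p) (fromℚᵘ q) ⟨
  toℚᵘ (fromℚᵘ p ℚ.+ fromℚᵘ q)               ∎)
  where open ℚᵘ.≃-Reasoning

fromℚᵘ-homo-* : ∀ p q → fromℚᵘ (p ℚᵘ.* q) ≡ fromℚᵘ p ℚ.* fromℚᵘ q
fromℚᵘ-homo-* p q = toℚᵘ-injective (begin
  toℚᵘ (fromℚᵘ (p ℚᵘ.* q))                  ≈⟨ toℚᵘ-fromℚᵘ (p ℚᵘ.* q) ⟩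
  p ℚᵘ.* q                                   ≈⟨ ℚᵘ.*-cong (toℚᵘ-fromℚᵘ p) (toℚᵘ-fromℚᵘ q) ⟨
  toℚᵘ (fromℚᵘ p) ℚᵘ.* toℚᵘ (fromℚᵘ q)       ≈⟨ toℚᵘ-homo-* (fromℚᵘ p) (fromℚᵘ q) ⟨
  toℚᵘ (fromℚᵘ p ℚ.* fromℚᵘ q)               ∎)
  where open ℚᵘ.≃-Reasoning

-- (+ n) / suc d-1 unfolds to fromℚᵘ (mkℚᵘ (+ n) d-1), so identities between such fractions
-- are transported from ℚᵘ, where they are cross-multiplication identities in ℤ.
+-/ : ∀ a b d .{{_ : NonZero d}} → (+ a) / d ℚ.+ (+ b) / d ≡ (+ (a ℕ.+ b)) / d
+-/ a b d@(suc d-1) = begin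
  fromℚᵘ a/d ℚ.+ fromℚᵘ b/d         ≡⟨ fromℚᵘ-homo-+ a/d b/d ⟨
  fromℚᵘ (a/d ℚᵘ.+ b/d)             ≡⟨ fromℚᵘ-cong {a/d ℚᵘ.+ b/d} {mkℚᵘ (+ (a ℕ.+ b)) d-1} (*≡* cross) ⟩
  fromℚᵘ (mkℚᵘ (+ (a ℕ.+ b)) d-1)   ∎
  where
  open ≡-Reasoning
  open +-*-Solver
  a/d = mkℚᵘ (+ a) d-1
  b/d = mkℚᵘ (+ b) d-1
  cross : (+ a ℤ.* + d ℤ.+ + b ℤ.* + d) ℤ.* + d ≡ + (a ℕ.+ b) ℤ.* + (d ℕ.* d)
  cross = trans (solve 3 (λ A B D → (A :* D :+ B :* D) :* D := (A :+ B) :* (D :* D)) refl (+ a) (+ b) (+ d))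
                (cong₂ ℤ._*_ (sym (ℤ.pos-+ a b)) (sym (ℤ.pos-* d d)))

*-/ : ∀ a b c d .{{_ : NonZero c}} .{{_ : NonZero d}} →
      ((+ a) / c) ℚ.* ((+ b) / d) ≡ ((+ (a ℕ.* b)) / (c ℕ.* d)) {{ℕ.m*n≢0 c d}}
*-/ a b c@(suc c-1) d@(suc d-1) = begin
  fromℚᵘ a/c ℚ.* fromℚᵘ b/d                      ≡⟨ fromℚᵘ-homo-* a/c b/d ⟨
  fromℚᵘ (mkℚᵘ (+ a ℤ.* + b) (ℕ.pred (c ℕ.* d)))  ≡⟨ cong (λ i → fromℚᵘ (mkℚᵘ i _)) (ℤ.pos-* a b) ⟨
  fromℚᵘ (mkℚᵘ (+ (a ℕ.* b)) (ℕ.pred (c ℕ.* d)))  ∎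
  where
  open ≡-Reasoning
  a/c = mkℚᵘ (+ a) c-1
  b/d = mkℚᵘ (+ b) d-1

0≤n/d : ∀ n d .{{_ : NonZero d}} → 0ℚ ℚ.≤ (+ n) / d
0≤n/d n d = ℚ.nonNegative⁻¹ _ {{ℚ.normalize-nonNeg n d}}

d≤n⇒1≤n/d : ∀ {n d} .{{_ : NonZero d}} → d ℕ.≤ n → 1ℚ ℚ.≤ (+ n) / d
d≤n⇒1≤n/d {n} {d@(suc d-1)} d≤n = ℚ.toℚᵘ-cancel-≤
  (ℚᵘ.≤-respʳ-≃ (ℚᵘ.≃-sym (toℚᵘ-fromℚᵘ (mkℚᵘ (+ n) d-1)))
    (*≤* (subst₂ ℤ._≤_ (sym (ℤ.*-identityˡ (+ d))) (sym (ℤ.*-identityʳ (+ n))) (ℤ.+≤+ d≤n))))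

sumℚ-const-/ : ∀ m d .{{_ : NonZero d}} → sumℚ {m} (λ _ → (+ 1) / d) ≡ (+ m) / d
sumℚ-const-/ zero    d = sym (ℚ.0/n≡0 d)
sumℚ-const-/ (suc m) d = trans (cong ((+ 1) / d ℚ.+_) (sumℚ-const-/ m d)) (+-/ 1 m d)

sumℚ-indicator-/ : ∀ {A : Set} {m} (P : A → Bool) (g : Fin m → A) d .{{_ : NonZero d}} →
                   sumℚ (λ i → if P (g i) then (+ 1) / d else 0ℚ) ≡ (+ length (filterᵇ P (tabulate g))) / d
sumℚ-indicator-/ {m = zero}  P g d = sym (ℚ.0/n≡0 d)
sumℚ-indicator-/ {m = suc m} P g d with P (g zero)
... | true  = trans (cong ((+ 1) / d ℚ.+_) (sumℚ-indicator-/ P (g ∘ suc) d)) (+-/ 1 _ d)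
... | false = trans (ℚ.+-identityˡ _) (sumℚ-indicator-/ P (g ∘ suc) d)

p<p+q : ∀ p {q} .{{_ : Positive q}} → p ℚ.< p ℚ.+ q
p<p+q p {q} = subst (ℚ._< p ℚ.+ q) (ℚ.+-identityʳ p) (ℚ.+-mono-≤-< (ℚ.≤-refl {p}) (ℚ.positive⁻¹ q))

∀∈⇒≤length : ∀ {n} (xs : List (Fin n)) → (∀ i → i ∈ xs) → n ℕ.≤ length xs
∀∈⇒≤length {n} xs i∈xs =
  injective⇒≤ (λ {i} {j} → index-injective (setoid (Fin n)) (i∈xs i) (i∈xs j))

support : ∀ {m} → EdgeSet m → List (Fin m)
support {m} C = filterᵇ C (allFin m)

∣_∣ : ∀ {m} → EdgeSet m → ℕ
∣ C ∣ = length (support C)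

∈-support : ∀ {m} {C : EdgeSet m} {e} → C e ≡ true → e ∈ support C
∈-support {C = C} {e} Ce = ∈-filter⁺ (T? ∘ C) (∈-allFin e) (subst T (sym Ce) _)

lengthOf-const-/ : ∀ {m} (C : EdgeSet m) d .{{_ : NonZero d}} →
                   lengthOf (λ _ → (+ 1) / d) C ≡ (+ ∣ C ∣) / d
lengthOf-const-/ C d = sumℚ-indicator-/ C (λ e → e) d

module _ {n m} (G : SimpleGraph n m) where

  endpoints : List (Fin m) → List (Fin n)
  endpoints es = map (proj₁ ∘ ends G) es ++ map (proj₂ ∘ ends G) es

  length-endpoints : ∀ es → length (endpoints es) ≡ length es ℕ.+ length es
  length-endpoints es = trans (length-++ (map (proj₁ ∘ ends G) es))
                              (cong₂ ℕ._+_ (length-map _ es) (length-map _ es))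

  edgeCover⇒∈endpoints : ∀ {C} → IsEdgeCover G C → ∀ v → v ∈ endpoints (support C)
  edgeCover⇒∈endpoints {C} cover v with cover v
  ... | e , Ce , inj₁ refl = ∈-++⁺ˡ (∈-map⁺ (proj₁ ∘ ends G) (∈-support Ce))
  ... | e , Ce , inj₂ refl =
    ∈-++⁺ʳ (map (proj₁ ∘ ends G) (support C)) (∈-map⁺ (proj₂ ∘ ends G) (∈-support Ce))

  edgeCover⇒⌈n/2⌉≤∣C∣ : ∀ {C} → IsEdgeCover G C → ⌈ n /2⌉ ℕ.≤ ∣ C ∣
  edgeCover⇒⌈n/2⌉≤∣C∣ {C} cover = begin
    ⌈ n /2⌉                               ≤⟨ ℕ.⌈n/2⌉-mono n≤∣endpoints∣ ⟩
    ⌈ length (endpoints (support C)) /2⌉  ≡⟨ cong ⌈_/2⌉ (length-endpoints (support C)) ⟩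
    ⌈ ∣ C ∣ ℕ.+ ∣ C ∣ /2⌉                 ≡⟨ ℕ.n≡⌈n+n/2⌉ ∣ C ∣ ⟨
    ∣ C ∣                                 ∎
    where
    open ℕ.≤-Reasoning
    n≤∣endpoints∣ : n ℕ.≤ length (endpoints (support C))
    n≤∣endpoints∣ = ∀∈⇒≤length (endpoints (support C)) (edgeCover⇒∈endpoints cover)

lemma3 : (n′ m : ℕ) (G : SimpleGraph (suc n′) m) →
    Mod2-ec≤ G ((+ m) / (⌈ suc n′ /2⌉ *ℕ ⌈ suc n′ /2⌉))
lemma3 n′ m G ε ε>0 = ρ , (ρ≥0 , ρ-admissible) , energy<c+ε
  where
  k = ⌈ suc n′ /2⌉
  c = (+ m) / (k *ℕ k)

  ρ : Density m
  ρ _ = (+ 1) / k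

  ρ≥0 : ∀ e → 0ℚ ℚ.≤ ρ e
  ρ≥0 _ = 0≤n/d 1 k

  ρ-admissible : ∀ C → IsEdgeCover G C → 1ℚ ℚ.≤ lengthOf ρ C
  ρ-admissible C cover =
    subst (1ℚ ℚ.≤_) (sym (lengthOf-const-/ C k)) (d≤n⇒1≤n/d (edgeCover⇒⌈n/2⌉≤∣C∣ G cover))

  energy≡c : energy ρ ≡ c
  energy≡c = trans (cong (λ x → sumℚ {m} (λ _ → x)) (*-/ 1 1 k k)) (sumℚ-const-/ m (k *ℕ k))

  energy<c+ε : energy ρ ℚ.< c ℚ.+ ε
  energy<c+ε = subst (ℚ._< c ℚ.+ ε) (sym energy≡c) (p<p+q c {{ε>0}})
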